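{- For all positive integers $M,n$ and all $j\in[M]$, we have $Y_j(M,n)=Y_1(M-j+1,n)$.
   Context: A hypergraph $H$ on $[n]$ is a set of subsets (edges) of $[n]$; throughout, hypergraphs are assumed inclusion-free (no $e\subsetneq e'$ in $H$). For $w:[n]\to[M]$ and strictly increasing $f:[M]\to\mathbb{R}_{>0}$, let $fw(e)=\sum_{i\in e}f(w(i))$; $w$ is isolating for $H,f$ if exactly one edge $e\in H$ attains the minimum of $fw$ over $H$ (by convention, if $H$ has no edges, every $w$ is isolating). For $j\in[M]$, $Z_j(H,M,f)$ is the set of isolating $w\in[M]^n$ with $\min_{x\in[n]}w(x)=j$, and $Y_j(M,n)=\min_{H,f}|Z_j(H,M,f)|$, the minimum over all hypergraphs $H$ on $[n]$ and all strictly increasing $f:[M]\to\mathbb{R}_{>0}$.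
   Formalization: The strictly increasing functions f over which $Y_j(M,n)$ is minimised take values in the positive rationals rather than in $\mathbb{R}_{>0}$. -}

module Defs where

open import Data.Nat as ℕ using (ℕ; zero; suc; _+_)
open import Data.Bool using (Bool; true; false; if_then_else_)
import Data.Bool.Properties as BoolP
open import Data.Fin as Fin using (Fin; toℕ)
import Data.Fin.Properties as FinP
open import Data.Fin.Subset using (Subset; _⊆_)
open import Data.Vec as Vec using (Vec; []; _∷_; zipWith)
import Data.Vec.Properties as VecP
import Data.Vec.Relation.Unary.All as VAll
import Data.Vec.Relation.Unary.Any as VAny
open import Data.List as List using (List; []; _∷_; length; filter; concatMap)
open import Data.List.Relation.Unary.All as LAll using (All)
open import Data.List.Relation.Unary.Any as LAny using (Any)
open import Data.List.Relation.Unary.Unique.Propositional using (Unique)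
open import Data.List.Membership.Propositional using (_∈_)
open import Data.Rational as ℚ using (ℚ; 0ℚ)
import Data.Rational.Properties as ℚP
open import Data.Product using (Σ; _×_; _,_)
open import Data.Sum using (_⊎_)
open import Relation.Binary.PropositionalEquality using (_≡_; _≢_; refl)
open import Relation.Nullary using (Dec; yes; no; ¬_)
open import Relation.Nullary.Decidable using (_×-dec_; _⊎-dec_)

-- Vertex set [n] = Fin n; weight set [M] = Fin M, where the element
-- i : Fin M stands for the number toℕ i + 1 ∈ {1,…,M}.

-- A hypergraph on [n]: a finite list of edges (subsets of [n]) without
-- repetitions (so it represents a set of edges) which is inclusion-free.
InclusionFree : ∀ {n} → List (Subset n) → Set
InclusionFree H = ∀ {e e'} → e ∈ H → e' ∈ H → e ⊆ e' → e ≡ e'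

IsHypergraph : ∀ {n} → List (Subset n) → Set
IsHypergraph H = Unique H × InclusionFree H

StrictlyIncreasingPos : ∀ {M} → (Fin M → ℚ) → Set
StrictlyIncreasingPos {M} f =
  (∀ i → 0ℚ ℚ.< f i) × (∀ i j → i Fin.< j → f i ℚ.< f j)

fw : ∀ {M n} → (Fin M → ℚ) → Vec (Fin M) n → Subset n → ℚ
fw f w e = Vec.foldr _ ℚ._+_ 0ℚ
  (zipWith (λ b x → if b then f x else 0ℚ) e w)

Isolating : ∀ {M n} → List (Subset n) → (Fin M → ℚ) → Vec (Fin M) n → Set
Isolating H f w =
  H ≡ [] ⊎ Any (λ e → All (λ e' → e' ≡ e ⊎ fw f w e ℚ.< fw f w e') H) H

-- min_{x ∈ [n]} w(x) = j  (j given as a natural number, 1-based)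
MinIs : ∀ {M n} → Vec (Fin M) n → ℕ → Set
MinIs w j = VAll.All (λ a → j ℕ.≤ suc (toℕ a)) w × VAny.Any (λ a → suc (toℕ a) ≡ j) w

isEmpty? : ∀ {A : Set} (xs : List A) → Dec (xs ≡ [])
isEmpty? [] = yes refl
isEmpty? (_ ∷ _) = no (λ ())

isolating? : ∀ {M n} (H : List (Subset n)) (f : Fin M → ℚ) (w : Vec (Fin M) n) →
             Dec (Isolating H f w)
isolating? H f w = isEmpty? H ⊎-dec
  LAny.any? (λ e → LAll.all? (λ e' → VecP.≡-dec BoolP._≟_ e' e ⊎-dec (fw f w e ℚP.<? fw f w e')) H) H

minIs? : ∀ {M n} (w : Vec (Fin M) n) (j : ℕ) → Dec (MinIs w j)
minIs? w j = VAll.all? (λ a → j ℕ.≤? suc (toℕ a)) w ×-dec VAny.any? (λ a → suc (toℕ a) ℕ.≟ j) w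

allVecs : ∀ M n → List (Vec (Fin M) n)
allVecs M zero = [] ∷ []
allVecs M (suc n) = concatMap (λ a → List.map (a ∷_) (allVecs M n)) (List.allFin M)

Zcard : ∀ M n → List (Subset n) → (Fin M → ℚ) → ℕ → ℕ
Zcard M n H f j = length (filter (λ w → isolating? H f w ×-dec minIs? w j) (allVecs M n))

IsY : ℕ → ℕ → ℕ → ℕ → Set
IsY j M n k =
  Σ (List (Subset n)) (λ H → Σ (Fin M → ℚ) (λ f →
      IsHypergraph H × StrictlyIncreasingPos f × Zcard M n H f j ≡ k))
  × (∀ (H : List (Subset n)) (f : Fin M → ℚ) →
       IsHypergraph H → StrictlyIncreasingPos f → k ℕ.≤ Zcard M n H f j)

-- A weight vector w with min w = d + j, where j ≥ 1, takes all its values in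
-- the top part {d+1, …, d+m} of [d+m], so it is the shift by d of a weight
-- vector on [m] with minimum j, and the shift carries f : [d+m] → ℚ to its restriction
-- f(d + ·).  Hence |Z_{d+j}(H, d+m, f)| = |Z_j(H, m, f(d + ·))|.  Every
-- admissible f on [m] is such a restriction, since it can be extended below
-- its least value by repeated halving.  So both minimisations range over the
-- same set of sizes, and Y_{d+j}(d+m, n) = Y_j(m, n).
module Submission where

open import Data.Nat as ℕ using (ℕ; zero; suc; _+_; _∸_; _≤_; s≤s)
import Data.Nat.Properties as ℕP
open import Data.Nat.ListAction using (sum)
open import Data.Fin as Fin using (Fin; toℕ; _↑ˡ_; _↑ʳ_)
import Data.Fin.Properties as FinP
open import Data.Rational as ℚ using (ℚ; 0ℚ; 1ℚ; ½)
import Data.Rational.Properties as ℚP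
open import Data.Bool using (true; false)
open import Data.Vec as Vec using (Vec; []; _∷_)
import Data.Vec.Functional as Vector
import Data.Vec.Relation.Unary.All as VAll
import Data.Vec.Relation.Unary.All.Properties as VAllP
import Data.Vec.Relation.Unary.Any as VAny
import Data.Vec.Relation.Unary.Any.Properties as VAnyP
open import Data.List as List using (List; length; filter; concatMap; tabulate; _++_)
import Data.List.Properties as ListP
import Data.List.Relation.Unary.All as LAll
import Data.List.Relation.Unary.Any as LAny
open import Data.Fin.Subset using (Subset)
open import Data.Product using (Σ-syntax; _×_; _,_; proj₁; proj₂)
import Data.Sum as Sum
open import Function using (_∘_; _⇔_; mk⇔; Equivalence)
open import Level using (0ℓ)
open import Relation.Binary.PropositionalEquality
open import Relation.Nullary using (¬_; yes; no)
open import Relation.Nullary.Decidable using (toWitness; _×-dec_)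
open import Relation.Unary using (Pred; Decidable)
open import Defs

private
  variable
    m n : ℕ

½<1 : ½ ℚ.< 1ℚ
½<1 = toWitness {a? = ½ ℚP.<? 1ℚ} _

0<½ : 0ℚ ℚ.< ½
0<½ = toWitness {a? = 0ℚ ℚP.<? ½} _

½*-pos : ∀ {x} → 0ℚ ℚ.< x → 0ℚ ℚ.< ½ ℚ.* x
½*-pos {x} 0<x = subst (ℚ._< ½ ℚ.* x) (ℚP.*-zeroˡ x)
  (ℚP.*-monoˡ-<-pos x {{ℚ.positive 0<x}} 0<½)

½*-< : ∀ {x} → 0ℚ ℚ.< x → ½ ℚ.* x ℚ.< x
½*-< {x} 0<x = subst (½ ℚ.* x ℚ.<_) (ℚP.*-identityˡ x)
  (ℚP.*-monoˡ-<-pos x {{ℚ.positive 0<x}} ½<1)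

halvings : ℕ → ℚ → ℚ
halvings zero    x = x
halvings (suc k) x = ½ ℚ.* halvings k x

halvings-pos : ∀ k {x} → 0ℚ ℚ.< x → 0ℚ ℚ.< halvings k x
halvings-pos zero    0<x = 0<x
halvings-pos (suc k) 0<x = ½*-pos (halvings-pos k 0<x)

halvings-suc-< : ∀ k {x} → 0ℚ ℚ.< x → halvings (suc k) x ℚ.< halvings k x
halvings-suc-< k 0<x = ½*-< (halvings-pos k 0<x)

StrictlyIncreasingPos-head-≤ : ∀ {g : Fin (suc m) → ℚ} → StrictlyIncreasingPos g →
                               ∀ a → g Fin.zero ℚ.≤ g a
StrictlyIncreasingPos-head-≤ sg Fin.zero    = ℚP.≤-refl
StrictlyIncreasingPos-head-≤ sg (Fin.suc a) = ℚP.<⇒≤ (proj₂ sg Fin.zero (Fin.suc a) (s≤s ℕ.z≤n))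

StrictlyIncreasingPos-∷ : ∀ {x} {g : Fin m → ℚ} → 0ℚ ℚ.< x → (∀ a → x ℚ.< g a) →
                          StrictlyIncreasingPos g → StrictlyIncreasingPos (x Vector.∷ g)
StrictlyIncreasingPos-∷ {x = x} {g} 0<x x<g sg = positive , increasing
  where
  positive : ∀ a → 0ℚ ℚ.< (x Vector.∷ g) a
  positive Fin.zero    = 0<x
  positive (Fin.suc a) = proj₁ sg a
  increasing : ∀ a b → a Fin.< b → (x Vector.∷ g) a ℚ.< (x Vector.∷ g) b
  increasing Fin.zero    (Fin.suc b) _         = x<g b
  increasing (Fin.suc a) (Fin.suc b) (s≤s a<b) = proj₂ sg a b a<b

StrictlyIncreasingPos-↑ʳ : ∀ d {f : Fin (d + m) → ℚ} → StrictlyIncreasingPos f →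
                           StrictlyIncreasingPos (f ∘ (d ↑ʳ_))
StrictlyIncreasingPos-↑ʳ d sf =
  (λ a → proj₁ sf (d ↑ʳ a)) ,
  (λ a b a<b → proj₂ sf (d ↑ʳ a) (d ↑ʳ b)
     (subst₂ ℕ._<_ (sym (FinP.toℕ-↑ʳ d a)) (sym (FinP.toℕ-↑ʳ d b)) (ℕP.+-monoʳ-< d a<b)))

extendBelow : ∀ d → ℚ → (Fin m → ℚ) → Fin (d + m) → ℚ
extendBelow zero    x g = g
extendBelow (suc d) x g = halvings (suc d) x Vector.∷ extendBelow d x g

extendBelow-↑ʳ : ∀ d {x} {g : Fin m → ℚ} a → extendBelow d x g (d ↑ʳ a) ≡ g a
extendBelow-↑ʳ zero    a = refl
extendBelow-↑ʳ (suc d) a = extendBelow-↑ʳ d a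

module _ {x : ℚ} {g : Fin m → ℚ} (0<x : 0ℚ ℚ.< x) (x≤g : ∀ a → x ℚ.≤ g a) where

  halvings-≤-extendBelow : ∀ d a → halvings d x ℚ.≤ extendBelow d x g a
  halvings-≤-extendBelow zero    a           = x≤g a
  halvings-≤-extendBelow (suc d) Fin.zero    = ℚP.≤-refl
  halvings-≤-extendBelow (suc d) (Fin.suc a) =
    ℚP.≤-trans (ℚP.<⇒≤ (halvings-suc-< d 0<x)) (halvings-≤-extendBelow d a)

  StrictlyIncreasingPos-extendBelow : StrictlyIncreasingPos g →
                                      ∀ d → StrictlyIncreasingPos (extendBelow d x g)
  StrictlyIncreasingPos-extendBelow sg zero    = sg
  StrictlyIncreasingPos-extendBelow sg (suc d) =
    StrictlyIncreasingPos-∷ (halvings-pos (suc d) 0<x)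
      (λ a → ℚP.<-≤-trans (halvings-suc-< d 0<x) (halvings-≤-extendBelow d a))
      (StrictlyIncreasingPos-extendBelow sg d)

fw-map : ∀ {M M′} {f : Fin M → ℚ} {g : Fin M′ → ℚ} {σ : Fin M′ → Fin M} →
         (∀ a → g a ≡ f (σ a)) → (w : Vec (Fin M′) n) (e : Subset n) →
         fw f (Vec.map σ w) e ≡ fw g w e
fw-map g≗fσ []      []          = refl
fw-map g≗fσ (a ∷ w) (true ∷ e)  = cong₂ ℚ._+_ (sym (g≗fσ a)) (fw-map g≗fσ w e)
fw-map g≗fσ (a ∷ w) (false ∷ e) = cong (0ℚ ℚ.+_) (fw-map g≗fσ w e)

Isolating-resp : ∀ {M M′} {H : List (Subset n)} {f : Fin M → ℚ} {g : Fin M′ → ℚ} {w v} →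
                 (∀ e → fw f w e ≡ fw g v e) → Isolating H f w → Isolating H g v
Isolating-resp fw≡ = Sum.map₂ (LAny.map (λ {e} → LAll.map (λ {e′} →
  Sum.map₂ (subst₂ ℚ._<_ (fw≡ e) (fw≡ e′)))))

suc-toℕ-↑ʳ : ∀ d (a : Fin m) → suc (toℕ (d ↑ʳ a)) ≡ d + suc (toℕ a)
suc-toℕ-↑ʳ d a = trans (cong suc (FinP.toℕ-↑ʳ d a)) (sym (ℕP.+-suc d (toℕ a)))

MinIs-↑ʳ : ∀ d j (w : Vec (Fin m) n) → MinIs w j ⇔ MinIs (Vec.map (d ↑ʳ_) w) (d + j)
MinIs-↑ʳ d j w = mk⇔
  (λ (lower , attained) →
     VAllP.map⁺ (VAll.map (λ {a} j≤a → subst (d + j ≤_) (sym (suc-toℕ-↑ʳ d a))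
                                          (ℕP.+-monoʳ-≤ d j≤a)) lower) ,
     VAnyP.map⁺ (VAny.map (λ {a} a≡j → trans (suc-toℕ-↑ʳ d a) (cong (d +_) a≡j)) attained))
  (λ (lower , attained) →
     VAll.map (λ {a} le → ℕP.+-cancelˡ-≤ d _ _ (subst (d + j ≤_) (suc-toℕ-↑ʳ d a) le))
       (VAllP.map⁻ lower) ,
     VAny.map (λ {a} eq → ℕP.+-cancelˡ-≡ d _ _ (trans (sym (suc-toℕ-↑ʳ d a)) eq))
       (VAnyP.map⁻ attained))

MinIs⇒shifted : ∀ d j {w : Vec (Fin (d + m)) n} → MinIs w (d + suc j) →
                VAll.All (λ a → d ≤ toℕ a) w
MinIs⇒shifted d j (lower , _) = VAll.map
  (λ {a} le → ℕP.≤-trans (ℕP.m≤m+n d j)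
                (ℕP.≤-pred (subst (_≤ suc (toℕ a)) (ℕP.+-suc d j) le)))
  lower

count : ∀ {A : Set} {P : Pred A 0ℓ} → Decidable P → List A → ℕ
count P? xs = length (filter P? xs)

module _ {A : Set} {P : Pred A 0ℓ} (P? : Decidable P) where

  count-++ : ∀ xs ys → count P? (xs ++ ys) ≡ count P? xs + count P? ys
  count-++ xs ys = trans (cong length (ListP.filter-++ P? xs ys)) (ListP.length-++ (filter P? xs))

  count-concatMap : ∀ {B : Set} (h : B → List A) xs →
                    count P? (concatMap h xs) ≡ sum (List.map (count P? ∘ h) xs)
  count-concatMap h List.[]       = refl
  count-concatMap h (x List.∷ xs) =
    trans (count-++ (h x) (concatMap h xs)) (cong (count P? (h x) +_) (count-concatMap h xs))

  count-none : (∀ x → ¬ P x) → ∀ xs → count P? xs ≡ 0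
  count-none ¬P xs = cong length (ListP.filter-none P? (LAll.universal ¬P xs))

count-map : ∀ {A B : Set} {P : Pred B 0ℓ} (P? : Decidable P) (g : A → B) xs →
            count P? (List.map g xs) ≡ count (P? ∘ g) xs
count-map P? g List.[]       = refl
count-map P? g (x List.∷ xs) with P? (g x)
... | yes _ = cong suc (count-map P? g xs)
... | no _  = count-map P? g xs

count-allVecs-suc : ∀ {M} {P : Pred (Vec (Fin M) (suc n)) 0ℓ} (P? : Decidable P) →
  count P? (allVecs M (suc n)) ≡ sum (tabulate (λ a → count (P? ∘ (a ∷_)) (allVecs M n)))
count-allVecs-suc {n} {M} P? = begin
  count P? (allVecs M (suc n))
    ≡⟨ count-concatMap P? (λ a → List.map (a ∷_) (allVecs M n)) (List.allFin M) ⟩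
  sum (List.map (λ a → count P? (List.map (a ∷_) (allVecs M n))) (List.allFin M))
    ≡⟨ cong sum (ListP.map-tabulate (λ a → a) (λ a → count P? (List.map (a ∷_) (allVecs M n)))) ⟩
  sum (tabulate (λ a → count P? (List.map (a ∷_) (allVecs M n))))
    ≡⟨ cong sum (ListP.tabulate-cong (λ a → count-map P? (a ∷_) (allVecs M n))) ⟩
  sum (tabulate (λ a → count (P? ∘ (a ∷_)) (allVecs M n))) ∎
  where open ≡-Reasoning

sum-tabulate-↑ʳ : ∀ d (h : Fin (d + m) → ℕ) → (∀ i → h (i ↑ˡ m) ≡ 0) →
                  sum (tabulate h) ≡ sum (tabulate (h ∘ (d ↑ʳ_)))
sum-tabulate-↑ʳ zero    h h↑ˡ≡0 = refl
sum-tabulate-↑ʳ (suc d) h h↑ˡ≡0 =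
  cong₂ _+_ (h↑ˡ≡0 Fin.zero) (sum-tabulate-↑ʳ d (h ∘ Fin.suc) (h↑ˡ≡0 ∘ Fin.suc))

count-allVecs-↑ʳ : ∀ d n {P : Pred (Vec (Fin (d + m)) n) 0ℓ} (P? : Decidable P) →
                   (∀ {w} → P w → VAll.All (λ a → d ≤ toℕ a) w) →
                   count P? (allVecs (d + m) n) ≡ count (P? ∘ Vec.map (d ↑ʳ_)) (allVecs m n)
count-allVecs-↑ʳ d zero    P? shifted with P? []
... | yes _ = refl
... | no _  = refl
count-allVecs-↑ʳ {m} d (suc n) {P} P? shifted = begin
  count P? (allVecs (d + m) (suc n))
    ≡⟨ count-allVecs-suc P? ⟩
  sum (tabulate (λ a → count (P? ∘ (a ∷_)) (allVecs (d + m) n)))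
    ≡⟨ sum-tabulate-↑ʳ d _ (λ i → count-none (P? ∘ ((i ↑ˡ m) ∷_)) (low i) (allVecs (d + m) n)) ⟩
  sum (tabulate (λ a → count (P? ∘ ((d ↑ʳ a) ∷_)) (allVecs (d + m) n)))
    ≡⟨ cong sum (ListP.tabulate-cong (λ a →
         count-allVecs-↑ʳ d n (P? ∘ ((d ↑ʳ a) ∷_)) (VAll.tail ∘ shifted))) ⟩
  sum (tabulate (λ a → count (P? ∘ Vec.map (d ↑ʳ_) ∘ (a ∷_)) (allVecs m n)))
    ≡⟨ count-allVecs-suc (P? ∘ Vec.map (d ↑ʳ_)) ⟨
  count (P? ∘ Vec.map (d ↑ʳ_)) (allVecs m (suc n)) ∎
  where
  open ≡-Reasoning
  low : ∀ i w → ¬ P ((i ↑ˡ m) ∷ w)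
  low i w p = ℕP.<⇒≱ (subst (ℕ._< d) (sym (FinP.toℕ-↑ˡ i m)) (FinP.toℕ<n i))
                     (VAll.head (shifted p))

Zcard-↑ʳ : ∀ d j (H : List (Subset n)) (f : Fin (d + m) → ℚ) (g : Fin m → ℚ) →
           (∀ a → g a ≡ f (d ↑ʳ a)) → Zcard (d + m) n H f (d + suc j) ≡ Zcard m n H g (suc j)
Zcard-↑ʳ {n} {m} d j H f g g≗f↑ʳ =
  trans (count-allVecs-↑ʳ d n Z? (MinIs⇒shifted d j ∘ proj₂))
        (cong length (ListP.filter-≐ (Z? ∘ Vec.map (d ↑ʳ_)) Z′? (to , from) (allVecs m n)))
  where
  Z? = λ w → isolating? H f w ×-dec minIs? w (d + suc j)
  Z′? = λ w → isolating? H g w ×-dec minIs? w (suc j)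
  to : ∀ {w} → Isolating H f (Vec.map (d ↑ʳ_) w) × MinIs (Vec.map (d ↑ʳ_) w) (d + suc j) →
       Isolating H g w × MinIs w (suc j)
  to {w} (iso , min) = Isolating-resp (fw-map g≗f↑ʳ w) iso ,
                       Equivalence.from (MinIs-↑ʳ d (suc j) w) min
  from : ∀ {w} → Isolating H g w × MinIs w (suc j) →
         Isolating H f (Vec.map (d ↑ʳ_) w) × MinIs (Vec.map (d ↑ʳ_) w) (d + suc j)
  from {w} (iso , min) = Isolating-resp (sym ∘ fw-map g≗f↑ʳ w) iso ,
                         Equivalence.to (MinIs-↑ʳ d (suc j) w) min

CountsRealisedIn : (j M j′ M′ n : ℕ) → Set
CountsRealisedIn j M j′ M′ n =
  ∀ (H : List (Subset n)) (f : Fin M → ℚ) → IsHypergraph H → StrictlyIncreasingPos f →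
  Σ[ g ∈ (Fin M′ → ℚ) ] StrictlyIncreasingPos g × Zcard M′ n H g j′ ≡ Zcard M n H f j

IsY-transfer : ∀ {j M j′ M′ k} → CountsRealisedIn j M j′ M′ n → CountsRealisedIn j′ M′ j M n →
               IsY j M n k → IsY j′ M′ n k
IsY-transfer {k = k} realise realise⁻ ((H , f , hH , sf , Z≡k) , minimal) =
  (let g , sg , Z≡ = realise H f hH sf in H , g , hH , sg , trans Z≡ Z≡k) ,
  λ H′ g′ hH′ sg′ → let f′ , sf′ , Z≡ = realise⁻ H′ g′ hH′ sg′ in
                    subst (k ≤_) Z≡ (minimal H′ f′ hH′ sf′)

restrict-realises : ∀ d j → CountsRealisedIn (d + suc j) (d + m) (suc j) m n
restrict-realises d j H f _ sf =
  f ∘ (d ↑ʳ_) , StrictlyIncreasingPos-↑ʳ d sf , sym (Zcard-↑ʳ d j H f (f ∘ (d ↑ʳ_)) (λ _ → refl))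

extend-realises : ∀ d j r → CountsRealisedIn (suc j) (suc r) (d + suc j) (d + suc r) n
extend-realises d j r H g _ sg =
  extendBelow d (g Fin.zero) g ,
  StrictlyIncreasingPos-extendBelow (proj₁ sg Fin.zero) (StrictlyIncreasingPos-head-≤ sg) sg d ,
  Zcard-↑ʳ d j H (extendBelow d (g Fin.zero) g) g (sym ∘ extendBelow-↑ʳ d)

IsY-shift : ∀ d j r n k → IsY (d + suc j) (d + suc r) n k ⇔ IsY (suc j) (suc r) n k
IsY-shift d j r n k = mk⇔
  (IsY-transfer (restrict-realises d j) (extend-realises d j r))
  (IsY-transfer (extend-realises d j r) (restrict-realises d j))

proposition4 : (M n j : ℕ) → 1 ≤ M → 1 ≤ n → 1 ≤ j → j ≤ M →
    (k : ℕ) → (IsY j M n k → IsY 1 (M ∸ j + 1) n k) × (IsY 1 (M ∸ j + 1) n k → IsY j M n k)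
proposition4 M n (suc d) _ _ _ j≤M k = Equivalence.to shift , Equivalence.from shift
  where
  r = M ∸ suc d
  shift : IsY (suc d) M n k ⇔ IsY 1 (r + 1) n k
  shift = subst₂ (λ j M′ → IsY j M′ n k ⇔ IsY 1 (r + 1) n k)
            (ℕP.+-comm d 1) (trans (ℕP.+-suc d r) (ℕP.m+[n∸m]≡n j≤M))
            (subst (λ m′ → IsY (d + 1) (d + suc r) n k ⇔ IsY 1 m′ n k)
              (ℕP.+-comm 1 r) (IsY-shift d 0 r n k))
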